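{- Let $n\geq 3$ and let $t$ be the $n$-dimensional tarai function on $\mathbb{Z}^n$, evaluated with call-by-need. For every $k\in\mathbb{N}$ with $2\leq k\leq n$, let $X_k$ be the set of all $\vec{x}\in\mathbb{Z}^n$ such that $\vec{x}(i)\leq\vec{x}(k)$ for every $i<k$. Then for every $k$ with $2\leq k\leq n$ and every $\vec{x}\in X_k$: (i) the evaluation of $t(\vec{x})$ terminates with call-by-need; (ii) $t(\vec{x})$ depends only on $\vec{x}\restriction\{1,\ldots,k\}$, i.e. if $\vec{x}'\in\mathbb{Z}^n$ satisfies $\vec{x}'(i)=\vec{x}(i)$ for all $i\in\{1,\ldots,k\}$, then $t(\vec{x}')=t(\vec{x})$; (iii) $t(\vec{x})\leq\vec{x}(k)$.
   Context: For $\vec{x}=\langle x_1,\ldots,x_n\rangle\in\mathbb{Z}^n$ write $\vec{x}(i)=x_i$, $\sigma(\vec{x})=\langle x_1-1,x_2,\ldots,x_n\rangle$ and $r(\vec{x})=\langle x_2,x_3,\ldots,x_n,x_1\rangle$ (so $r^{i-1}(\vec{x})=\langle x_i,\ldots,x_n,x_1,\ldots,x_{i-1}\rangle$). The $n$-dimensional tarai function $t$ is defined by the recursion: if $\vec{x}(1)\leq\vec{x}(2)$ then $t(\vec{x})=\vec{x}(2)$; otherwise $t(\vec{x})=t(\vec{y})$ where $\vec{y}(i)=t(\sigma(r^{i-1}(\vec{x})))$ for $i=1,\ldots,n$. Evaluation with call-by-need means: the arguments $\vec{y}(i)$ of the outer call are passed unevaluated (as delayed computations), and each is evaluated (at most once)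 only when its value is actually needed by the computation, e.g. when it is compared in the test $\vec{y}(1)\leq\vec{y}(2)$ or returned; arguments whose values are never needed are never evaluated. "Terminates" means this evaluation process is finite. -}

module Defs where

open import Data.Nat using (ℕ; zero; suc)
open import Data.Nat.DivMod using (_mod_)
open import Data.Integer using (ℤ; _-_; _≤_; _<_; +_)
open import Data.Fin using (Fin; toℕ) renaming (zero to fz; suc to fs)

-- Dimension n = suc (suc m)  (the definition needs positions 1 and 2).
-- Vectors in Z^n (or of expressions) are functions Fin n → A (0-based indices:
-- paper's x(i) is x (i-1) here).

module _ {A : Set} where

  -- index successor modulo n (n = suc _ ensures NonZero)
  -- r(x) = ⟨x_2,...,x_n,x_1⟩
  r : {m : ℕ} → (Fin (suc m) → A) → (Fin (suc m) → A)
  r {m} x j = x ((suc (toℕ j)) mod (suc m))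

  rpow : {m : ℕ} → ℕ → (Fin (suc m) → A) → (Fin (suc m) → A)
  rpow zero    x = x
  rpow (suc i) x = r (rpow i x)

-- Syntax of the (lazy) computations occurring in the evaluation of tarai:
-- an integer literal, a delayed "e - 1", or a delayed call of t on a vector
-- of delayed arguments.
data Exp (m : ℕ) : Set where
  lit   : ℤ → Exp m
  dec   : Exp m → Exp m
  tarai : (Fin (suc (suc m)) → Exp m) → Exp m

σ : {m : ℕ} → (Fin (suc (suc m)) → Exp m) → (Fin (suc (suc m)) → Exp m)
σ x fz     = dec (x fz)
σ x (fs j) = x (fs j)

-- the delayed arguments y(i) = t(σ(r^{i-1}(x)))  (0-based: i ↦ r^i)
ys : {m : ℕ} → (Fin (suc (suc m)) → Exp m) → (Fin (suc (suc m)) → Exp m)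
ys x i = tarai (σ (rpow (toℕ i) x))

-- Big-step lazy (call-by-need / call-by-name) evaluation: e ⇓ v means the
-- evaluation of e terminates with value v.  Only the arguments actually
-- needed (the first two, for the test) are evaluated.
infix 4 _⇓_
data _⇓_ {m : ℕ} : Exp m → ℤ → Set where
  ⇓lit  : ∀ {z} → lit z ⇓ z
  ⇓dec  : ∀ {e v} → e ⇓ v → dec e ⇓ (v - + 1)
  ⇓stop : ∀ {x a b} → x fz ⇓ a → x (fs fz) ⇓ b → a ≤ b → tarai x ⇓ b
  ⇓rec  : ∀ {x a b v} → x fz ⇓ a → x (fs fz) ⇓ b → b < a →
          tarai (ys x) ⇓ v → tarai x ⇓ v

T : {m : ℕ} → (Fin (suc (suc m)) → ℤ) → Exp m
T x = tarai (λ i → lit (x i))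

-- Induction on k and, for fixed k, on the gap x(1) − x(2).  If x(1) ≤ x(2) the
-- call stops with x(2) ≤ x(k).  Otherwise t(x) = t(y) with y(i) = t(σ(r^{i-1}(x))):
-- y(1) is the same situation with a smaller gap; for 1 < i < k − 1 the vector
-- σ(r^{i-1}(x)) lies in X_{k-i+1} with the same bound x(k); and y(k-1) stops at
-- once with value x(k).  Hence y ∈ X_{k-1} with y(k-1) = x(k), so by induction only
-- y(1), …, y(k-1) are ever evaluated, each depending only on x(1), …, x(k).
module Submission where

open import Defs
open import Data.Nat using (ℕ; suc)
open import Data.Fin using (Fin; toℕ)
open import Data.Integer using (ℤ; _≤_)
open import Data.Product using (Σ; _×_)
open import Relation.Binary.PropositionalEquality using (_≡_)

open import Data.Nat as ℕ using (zero; z≤n; s≤s; _∸_)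
import Data.Nat.Properties as ℕₚ
open import Data.Nat.Induction using (<-rec)
open import Data.Nat.DivMod using (_mod_; m<n⇒m%n≡m)
open import Data.Integer as ℤ using (+_; -[1+_]; -≤+; _-_; ∣_∣; _≤?_)
import Data.Integer.Properties as ℤₚ
open import Data.Integer.Tactic.RingSolver using (solve-∀)
open import Data.Fin using (fromℕ<) renaming (zero to fz; suc to fs)
open import Data.Fin.Properties using (toℕ-fromℕ<; toℕ-injective; toℕ<n)
open import Data.Product using (_,_; proj₂)
open import Data.Sum using (inj₁; inj₂)
open import Data.Empty using (⊥-elim)
open import Relation.Binary.Definitions using (tri<; tri≈; tri>)
open import Relation.Binary.PropositionalEquality using (refl; sym; trans; cong; subst; subst₂)
open import Relation.Nullary using (yes; no)

i≤+∣i∣ : ∀ i → i ≤ + ∣ i ∣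
i≤+∣i∣ (+ _)     = ℤₚ.≤-refl
i≤+∣i∣ -[1+ _ ] = -≤+

i-j≤1+d⇒i-1-j≤d : ∀ i j d → i - j ≤ + suc d → i - + 1 - j ≤ + d
i-j≤1+d⇒i-1-j≤d i j d gap = subst (_≤ + d) (swap i j) (ℤₚ.+-monoˡ-≤ (ℤ.- + 1) gap)
  where
  swap : ∀ i j → i - j - + 1 ≡ i - + 1 - j
  swap = solve-∀

module Tarai (m : ℕ) where

  n : ℕ
  n = suc (suc m)

  toℕ-suc-mod : (p : Fin n) → suc (toℕ p) ℕ.< n → toℕ (suc (toℕ p) mod n) ≡ suc (toℕ p)
  toℕ-suc-mod p lt = trans (toℕ-fromℕ< _) (m<n⇒m%n≡m lt)

  rpow-lookup : {A : Set} (j : ℕ) (x : Fin n → A) (p q : Fin n) →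
                toℕ q ≡ toℕ p ℕ.+ j → rpow j x p ≡ x q
  rpow-lookup zero    x p q q≡p+0 = cong x (toℕ-injective (trans (sym (ℕₚ.+-identityʳ _)) (sym q≡p+0)))
  rpow-lookup (suc j) x p q q≡p+1+j =
    rpow-lookup j x (suc (toℕ p) mod n) q
      (trans q≡p+1+j (trans (ℕₚ.+-suc (toℕ p) j) (cong (ℕ._+ j) (sym (toℕ-suc-mod p p+1<n)))))
    where
    p+1≤q : suc (toℕ p) ℕ.≤ toℕ q
    p+1≤q = subst (suc (toℕ p) ℕ.≤_) (sym (trans q≡p+1+j (ℕₚ.+-suc (toℕ p) j)))
                  (s≤s (ℕₚ.m≤m+n (toℕ p) j))
    p+1<n : suc (toℕ p) ℕ.< n
    p+1<n = ℕₚ.≤-<-trans p+1≤q (toℕ<n q)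

  σℤ : (Fin n → ℤ) → (Fin n → ℤ)
  σℤ a fz     = a fz - + 1
  σℤ a (fs i) = a (fs i)

  EvaluatesUpTo : ℕ → (Fin n → Exp m) → (Fin n → ℤ) → Set
  EvaluatesUpTo k e a = ∀ i → toℕ i ℕ.≤ k → e i ⇓ a i

  evaluatesUpTo-σ : ∀ {k e a} → EvaluatesUpTo k e a → EvaluatesUpTo k (σ e) (σℤ a)
  evaluatesUpTo-σ ev fz     i≤k = ⇓dec (ev fz i≤k)
  evaluatesUpTo-σ ev (fs i) i≤k = ev (fs i) i≤k

  shiftedIndex : ∀ {k} j → j ℕ.≤ k → k ℕ.< n → (p : Fin n) → toℕ p ℕ.≤ k ∸ j →
                 Σ (Fin n) λ q → toℕ q ≡ toℕ p ℕ.+ j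
  shiftedIndex j j≤k k<n p p≤k-j = fromℕ< p+j<n , toℕ-fromℕ< p+j<n
    where
    p+j<n : toℕ p ℕ.+ j ℕ.< n
    p+j<n = ℕₚ.≤-<-trans (subst (toℕ p ℕ.+ j ℕ.≤_) (ℕₚ.m∸n+n≡m j≤k) (ℕₚ.+-monoˡ-≤ j p≤k-j)) k<n

  evaluatesUpTo-rpow : ∀ {k e a} j → j ℕ.≤ k → k ℕ.< n →
                       EvaluatesUpTo k e a → EvaluatesUpTo (k ∸ j) (rpow j e) (rpow j a)
  evaluatesUpTo-rpow {k} {e} {a} j j≤k k<n ev p p≤k-j with shiftedIndex j j≤k k<n p p≤k-j
  ... | q , q≡p+j = subst₂ _⇓_ (sym (rpow-lookup j e p q q≡p+j)) (sym (rpow-lookup j a p q q≡p+j)) (ev q q≤k)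
    where
    q≤k : toℕ q ℕ.≤ k
    q≤k = subst₂ ℕ._≤_ (sym q≡p+j) (ℕₚ.m∸n+n≡m j≤k) (ℕₚ.+-monoˡ-≤ j p≤k-j)

  CappedAt : ℕ → (Fin n → ℤ) → ℤ → Set
  CappedAt k a c = (∀ i → toℕ i ℕ.< k → a i ≤ c) × (∀ i → toℕ i ≡ k → a i ≡ c)

  cappedAt-≤ : ∀ {k a c} → CappedAt k a c → ∀ i → toℕ i ℕ.≤ k → a i ≤ c
  cappedAt-≤ (below , at) i i≤k with ℕₚ.m≤n⇒m<n∨m≡n i≤k
  ... | inj₁ i<k = below i i<k
  ... | inj₂ i≡k = ℤₚ.≤-reflexive (at i i≡k)

  cappedAt-1-ordered : ∀ {a c} → CappedAt 1 a c → a fz ≤ a (fs fz)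
  cappedAt-1-ordered {a} cap@(_ , at) = subst (a fz ≤_) (sym (at (fs fz) refl)) (cappedAt-≤ cap fz z≤n)

  cappedAt-σ : ∀ {k a c} → 1 ℕ.≤ k → CappedAt k a c → CappedAt k (σℤ a) c
  cappedAt-σ {k} {a} {c} 1≤k (below , at) = below′ , at′
    where
    below′ : ∀ i → toℕ i ℕ.< k → σℤ a i ≤ c
    below′ fz     i<k = ℤₚ.≤-trans (ℤₚ.i-j≤i (a fz) (+ 1)) (below fz i<k)
    below′ (fs i) i<k = below (fs i) i<k
    at′ : ∀ i → toℕ i ≡ k → σℤ a i ≡ c
    at′ fz     0≡k = ⊥-elim (ℕₚ.<⇒≢ 1≤k 0≡k)
    at′ (fs i) i≡k = at (fs i) i≡k

  cappedAt-rpow : ∀ {k a c} j → j ℕ.≤ k → k ℕ.< n → CappedAt k a c → CappedAt (k ∸ j) (rpow j a) c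
  cappedAt-rpow {k} {a} {c} j j≤k k<n (below , at) = below′ , at′
    where
    below′ : ∀ p → toℕ p ℕ.< k ∸ j → rpow j a p ≤ c
    below′ p p<k-j with shiftedIndex j j≤k k<n p (ℕₚ.<⇒≤ p<k-j)
    ... | q , q≡p+j = subst (_≤ c) (sym (rpow-lookup j a p q q≡p+j)) (below q q<k)
      where
      q<k : toℕ q ℕ.< k
      q<k = subst₂ ℕ._<_ (sym q≡p+j) (ℕₚ.m∸n+n≡m j≤k) (ℕₚ.+-monoˡ-< j p<k-j)
    at′ : ∀ p → toℕ p ≡ k ∸ j → rpow j a p ≡ c
    at′ p p≡k-j with shiftedIndex j j≤k k<n p (ℕₚ.≤-reflexive p≡k-j)
    ... | q , q≡p+j = trans (rpow-lookup j a p q q≡p+j) (at q q≡k)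
      where
      q≡k : toℕ q ≡ k
      q≡k = trans q≡p+j (trans (cong (ℕ._+ j) p≡k-j) (ℕₚ.m∸n+n≡m j≤k))

  Determined : ℕ → (Fin n → ℤ) → ℤ → Set
  Determined k a c = Σ ℤ λ v → v ≤ c × (∀ e → EvaluatesUpTo k e a → tarai e ⇓ v)

  determined-stop : ∀ {k a c} → 1 ℕ.≤ k → CappedAt k a c → a fz ≤ a (fs fz) → Determined k a c
  determined-stop {a = a} 1≤k cap a₀≤a₁ =
    a (fs fz) , cappedAt-≤ cap (fs fz) 1≤k , λ e ev → ⇓stop (ev fz z≤n) (ev (fs fz) 1≤k) a₀≤a₁

  -- c stands for x(k), and d bounds the gap x(1) − x(2), the measure of the inner induction.
  TaraiBound : ℕ → Set
  TaraiBound k = 1 ℕ.≤ k → k ℕ.< n → ∀ d a c → CappedAt k a c → a fz - a (fs fz) ≤ + d →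
                 Determined k a c

  -- The argument y(i) of the recursive call for x ∈ X_{κ+1}; arguments beyond
  -- position κ are never evaluated, so nothing is claimed about them.
  record Argument (κ : ℕ) (a : Fin n → ℤ) (c : ℤ) (i : Fin n) : Set where
    field
      value     : ℤ
      below     : toℕ i ℕ.< κ → value ≤ c
      at        : toℕ i ≡ κ → value ≡ c
      evaluates : toℕ i ℕ.≤ κ → ∀ e → EvaluatesUpTo (suc κ) e a → ys e i ⇓ value

  module Unfold {κ a c} (1≤κ : 1 ℕ.≤ κ) (k<n : suc κ ℕ.< n) (ih : ∀ {k} → k ℕ.< suc κ → TaraiBound k)
                (cap : CappedAt (suc κ) a c) (first : Determined (suc κ) (σℤ a) c) where

    rotated-capped : ∀ j → j ℕ.< suc κ → CappedAt (suc κ ∸ j) (σℤ (rpow j a)) c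
    rotated-capped j j<k = cappedAt-σ (ℕₚ.m<n⇒0<n∸m j<k) (cappedAt-rpow j (ℕₚ.<⇒≤ j<k) k<n cap)

    rotated-evaluates : ∀ j → j ℕ.< suc κ → ∀ e → EvaluatesUpTo (suc κ) e a →
                        EvaluatesUpTo (suc κ ∸ j) (σ (rpow j e)) (σℤ (rpow j a))
    rotated-evaluates j j<k e ev = evaluatesUpTo-σ (evaluatesUpTo-rpow j (ℕₚ.<⇒≤ j<k) k<n ev)

    argument : ∀ i → Argument κ a c i
    argument fz = from-first first
      where
      from-first : Determined (suc κ) (σℤ a) c → Argument κ a c fz
      from-first (v₀ , v₀≤c , ⇓v₀) = record
        { value = v₀ ; below = λ _ → v₀≤c ; at = λ 0≡κ → ⊥-elim (ℕₚ.<⇒≢ 1≤κ 0≡κ)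
        ; evaluates = λ _ e ev → ⇓v₀ (σ e) (evaluatesUpTo-σ ev) }
    argument (fs i) with ℕₚ.<-cmp (suc (toℕ i)) κ
    ... | tri< j<κ _ _ = from-determined (ih r<k (ℕₚ.m<n⇒0<n∸m j<k) (ℕₚ.≤-<-trans (ℕₚ.m∸n≤m (suc κ) j) k<n)
                                             _ _ c (rotated-capped j j<k) (i≤+∣i∣ _))
      where
      j : ℕ
      j = suc (toℕ i)
      j<k : j ℕ.< suc κ
      j<k = ℕₚ.<-trans j<κ (ℕₚ.n<1+n κ)
      r<k : suc κ ∸ j ℕ.< suc κ
      r<k = ℕₚ.∸-monoʳ-< (s≤s z≤n) (ℕₚ.<⇒≤ j<k)
      from-determined : Determined (suc κ ∸ j) (σℤ (rpow j a)) c → Argument κ a c (fs i)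
      from-determined (w , w≤c , ⇓w) = record
        { value = w ; below = λ _ → w≤c ; at = λ j≡κ → ⊥-elim (ℕₚ.<-irrefl j≡κ j<κ)
        ; evaluates = λ _ e ev → ⇓w _ (rotated-evaluates j j<k e ev) }
    ... | tri≈ _ j≡κ _ = record
      { value = c ; below = λ j<κ → ⊥-elim (ℕₚ.<-irrefl j≡κ j<κ) ; at = λ _ → refl
      ; evaluates = λ _ e ev → stops (subst (λ r → EvaluatesUpTo r (σ (rpow j e)) (σℤ (rpow j a))) r≡1
                                            (rotated-evaluates j j<k e ev)) }
      where
      j : ℕ
      j = suc (toℕ i)
      j<k : j ℕ.< suc κ
      j<k = subst (ℕ._< suc κ) (sym j≡κ) (ℕₚ.n<1+n κ)
      r≡1 : suc κ ∸ j ≡ 1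
      r≡1 = trans (cong (suc κ ∸_) j≡κ) (ℕₚ.m+n∸n≡m 1 κ)
      cap₁ : CappedAt 1 (σℤ (rpow j a)) c
      cap₁ = subst (λ r → CappedAt r (σℤ (rpow j a)) c) r≡1 (rotated-capped j j<k)
      stops : ∀ {e} → EvaluatesUpTo 1 e (σℤ (rpow j a)) → tarai e ⇓ c
      stops ev₁ = subst (tarai _ ⇓_) (proj₂ cap₁ (fs fz) refl)
                        (⇓stop (ev₁ fz z≤n) (ev₁ (fs fz) ℕₚ.≤-refl) (cappedAt-1-ordered cap₁))
    ... | tri> _ _ κ<j = record
      { value = c ; below = λ j<κ → ⊥-elim (ℕₚ.<⇒≱ j<κ (ℕₚ.<⇒≤ κ<j))
      ; at = λ j≡κ → ⊥-elim (ℕₚ.<-irrefl (sym j≡κ) κ<j)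
      ; evaluates = λ j≤κ → ⊥-elim (ℕₚ.<⇒≱ κ<j j≤κ) }

    values : Fin n → ℤ
    values i = Argument.value (argument i)

    values-capped : CappedAt κ values c
    values-capped = (λ i → Argument.below (argument i)) , (λ i → Argument.at (argument i))

    values-evaluate : ∀ e → EvaluatesUpTo (suc κ) e a → EvaluatesUpTo κ (ys e) values
    values-evaluate e ev i i≤κ = Argument.evaluates (argument i) i≤κ e ev

    unfold : a (fs fz) ℤ.< a fz → Determined (suc κ) a c
    unfold a₁<a₀ with ih (ℕₚ.n<1+n κ) 1≤κ (ℕₚ.<-trans (ℕₚ.n<1+n κ) k<n) _ values c values-capped (i≤+∣i∣ _)
    ... | v , v≤c , ⇓v = v , v≤c , λ e ev →
      ⇓rec (ev fz z≤n) (ev (fs fz) (s≤s z≤n)) a₁<a₀ (⇓v (ys e) (values-evaluate e ev))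

  tarai-capped-step : ∀ k → (∀ {k′} → k′ ℕ.< k → TaraiBound k′) → TaraiBound k
  tarai-capped-step zero          _  ()
  tarai-capped-step (suc zero)    _  _ _   _ _ _ cap _ = determined-stop ℕₚ.≤-refl cap (cappedAt-1-ordered cap)
  tarai-capped-step (suc (suc κ)) ih _ k<n = descend
    where
    descend : ∀ d a c → CappedAt (suc (suc κ)) a c → a fz - a (fs fz) ≤ + d → Determined (suc (suc κ)) a c
    descend d a c cap gap with a fz ≤? a (fs fz)
    ... | yes a₀≤a₁ = determined-stop (s≤s z≤n) cap a₀≤a₁
    descend zero    a c cap gap | no a₀≰a₁ = ⊥-elim (a₀≰a₁ (ℤₚ.i-j≤0⇒i≤j gap))
    descend (suc d) a c cap gap | no a₀≰a₁ =
      Unfold.unfold (s≤s z≤n) k<n ih cap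
        (descend d (σℤ a) c (cappedAt-σ (s≤s z≤n) cap) (i-j≤1+d⇒i-1-j≤d (a fz) (a (fs fz)) d gap))
        (ℤₚ.≰⇒> a₀≰a₁)

  tarai-capped : ∀ k → TaraiBound k
  tarai-capped = <-rec TaraiBound tarai-capped-step

lemma1p1 : (m : ℕ) → 3 Data.Nat.≤ suc (suc m) →
    (k : Fin (suc (suc m))) → 1 Data.Nat.≤ toℕ k →
    (x : Fin (suc (suc m)) → ℤ) →
    ((i : Fin (suc (suc m))) → toℕ i Data.Nat.< toℕ k → x i ≤ x k) →
    Σ ℤ (λ v → (T x ⇓ v)
      × ((x′ : Fin (suc (suc m)) → ℤ) →
           ((i : Fin (suc (suc m))) → toℕ i Data.Nat.≤ toℕ k → x′ i ≡ x i) →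
           T x′ ⇓ v)
      × v ≤ x k)
lemma1p1 m _ k 1≤k x below with
  Tarai.tarai-capped m (toℕ k) 1≤k (toℕ<n k) _ x (x k) (below , λ i i≡k → cong x (toℕ-injective i≡k)) (i≤+∣i∣ _)
... | v , v≤xk , ⇓v =
  v , ⇓v _ (λ _ _ → ⇓lit) , (λ x′ agree → ⇓v _ (λ i i≤k → subst (lit (x′ i) ⇓_) (agree i i≤k) ⇓lit)) , v≤xk
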